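{- Let $d \geq 0$ be an integer with $d \equiv 0 \pmod{3}$ and $d \neq 6$. Then the graph $G_3(d)$ has exactly one maximum independent set, i.e. $\mathrm{a}_3(d) = 1$.
   Context: For integers $n \geq 1$ and $d \geq 0$, let $S_n(d)$ be the set of monomials of degree $d$ in the polynomial ring $\mathbb{F}[x_1,\dots,x_n]$ over a field $\mathbb{F}$. The graph $G_n(d)$ has vertex set $S_n(d)$, and two monomials $f,g \in S_n(d)$ are adjacent if and only if $\mathrm{lcm}(f,g)$ has degree $d+1$. (Equivalently, vertices are $n$-tuples of nonnegative integers summing to $d$, adjacent iff their $L_1$ distance is $2$.) A maximum independent set is an independent set of largest possible size, and $\mathrm{a}_n(d)$ denotes the number of maximum independent sets of $G_n(d)$. -}

module Defs where

open import Data.Nat using (ℕ; suc; _⊔_; _≤_)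
open import Data.Vec using (Vec; zipWith; sum)
open import Data.List using (List; length)
open import Data.List.Membership.Propositional using (_∈_)
open import Data.List.Relation.Unary.All using (All)
open import Data.List.Relation.Unary.Unique.Propositional using (Unique)
open import Data.Product using (_×_; ∃-syntax)
open import Relation.Binary.PropositionalEquality using (_≡_)
open import Relation.Nullary using (¬_)
open import Function.Bundles using (_⇔_)

-- A monomial in F[x_1,...,x_n] is represented by its exponent vector.
Monomial : ℕ → Set
Monomial n = Vec ℕ n

deg : ∀ {n} → Monomial n → ℕ
deg = sum

lcm : ∀ {n} → Monomial n → Monomial n → Monomial n
lcm = zipWith _⊔_

InS : (n d : ℕ) → Monomial n → Set
InS n d f = deg f ≡ d

Adj : (n d : ℕ) → Monomial n → Monomial n → Set
Adj n d f g = deg (lcm f g) ≡ suc d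

-- A finite set of vertices of G_n(d): a duplicate-free list of monomials of degree d.
-- Its cardinality is the length of the list.
IsVertexSet : (n d : ℕ) → List (Monomial n) → Set
IsVertexSet n d I = Unique I × All (InS n d) I

IsIndependent : (n d : ℕ) → List (Monomial n) → Set
IsIndependent n d I =
  IsVertexSet n d I × (∀ {f g} → f ∈ I → g ∈ I → ¬ Adj n d f g)

IsMaximumIndependent : (n d : ℕ) → List (Monomial n) → Set
IsMaximumIndependent n d I =
  IsIndependent n d I × (∀ J → IsIndependent n d J → length J ≤ length I)

SameSet : ∀ {n} → List (Monomial n) → List (Monomial n) → Set
SameSet I J = ∀ f → (f ∈ I) ⇔ (f ∈ J)

HasUniqueMaxIndependentSet : (n d : ℕ) → Set
HasUniqueMaxIndependentSet n d =
  ∃[ I ] (IsMaximumIndependent n d I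
          × (∀ J → IsMaximumIndependent n d J → SameSet J I))

-- The vertices of G₃(d) are the lattice points of a triangle of side d and its maximal cliques
-- are the unit triangles. Let C be the points whose three coordinates are congruent mod 3; a unit
-- move changes exactly two residues, so C is independent. Attach to every point of C a weighted
-- set of unit triangles through it (weights from a fixed table, scaled by 12), so that the
-- resulting multiset of triangles has 12|C| members and every vertex lies in at least 12 of them.
-- Since an independent set meets a triangle at most once, it has at most |C| points. For an
-- independent J with |J| = |C| everything is tight: J meets every triangle of the cover and no
-- vertex of J lies in more than 12 of them. The two neighbours of the corner (d,0,0) lie in 13,
-- so the corner is in J; moving away from it, every point of C is the only vertex of one of its
-- triangles that is not adjacent to a point of C already known to lie in J. Hence J = C.
-- The table only sees coordinates capped at 4 and residues mod 3, so its requirements are checked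
-- by computation on finitely many representative points; they fail only for d = 6.

module Submission where

open import Defs
open import Data.Bool using (Bool; true; false; T; _∧_; if_then_else_)
open import Data.Bool.Properties using (T-∧)
open import Data.Empty using (⊥; ⊥-elim)
open import Data.List using (List; []; _∷_; _++_; length; map; replicate; concatMap; filter; upTo; cartesianProductWith)
open import Data.List.Membership.Propositional using (_∈_; _∉_; find; lose)
open import Data.List.Membership.Propositional.Properties
  using (∈-∃++; ∈-++⁻; ∈-++⁺ˡ; ∈-++⁺ʳ; ∈-map⁺; ∈-map⁻; ∈-filter⁺; ∈-filter⁻; ∈-upTo⁺; ∈-cartesianProductWith⁺)
open import Data.List.Properties using (length-++; length-replicate; map-++; map-cong; map-∘)
open import Data.List.Relation.Unary.All using (All; []; _∷_; all?)
import Data.List.Relation.Unary.All as All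
import Data.List.Relation.Unary.All.Properties as AllP
open import Data.List.Relation.Unary.AllPairs using ([]; _∷_)
open import Data.List.Relation.Unary.Any using (here; there; any?)
import Data.List.Relation.Unary.Any.Properties as Any
open import Data.List.Relation.Unary.Unique.Propositional using (Unique)
import Data.List.Relation.Unary.Unique.Propositional.Properties as Unique
open import Data.Nat using (ℕ; zero; suc; _+_; _*_; _∸_; _⊔_; _⊓_; _%_; pred; _≤_; _<_; z≤n; s≤s; _≤?_; _<?_)
open import Data.Nat.DivMod using (%-distribˡ-+; m%n%n≡m%n; m%n<n)
open import Data.Nat.ListAction using (sum)
open import Data.Nat.ListAction.Properties using (sum-++)
open import Data.Nat.Properties
open import Data.Nat.Tactic.RingSolver using (solve-∀)
open import Data.Product using (_×_; _,_; ∃; proj₁; proj₂)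
open import Data.Sum using (_⊎_; inj₁; inj₂)
open import Data.Unit using (tt)
open import Data.Vec using ([]; _∷_)
import Data.Vec.Properties as Vec
open import Function using (_∘_; Equivalence)
open import Function.Bundles using (mk⇔)
open import Relation.Binary.Definitions using (DecidableEquality)
open import Relation.Binary.PropositionalEquality
open import Relation.Nullary using (¬_; Dec; yes; no; isYes)
open import Relation.Nullary.Decidable using (T?; toWitness; from-yes; ¬?; _×-dec_; _→-dec_)
open import Relation.Unary using (Decidable)

1+n⊔n≡1+n : ∀ n → suc n ⊔ n ≡ suc n
1+n⊔n≡1+n n = m≥n⇒m⊔n≡m (n≤1+n n)

n⊔1+n≡1+n : ∀ n → n ⊔ suc n ≡ suc n
n⊔1+n≡1+n n = m≤n⇒m⊔n≡n (n≤1+n n)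

m⊔n≡m+[n∸m] : ∀ m n → m ⊔ n ≡ m + (n ∸ m)
m⊔n≡m+[n∸m] zero n = refl
m⊔n≡m+[n∸m] (suc m) zero = sym (+-identityʳ (suc m))
m⊔n≡m+[n∸m] (suc m) (suc n) = cong suc (m⊔n≡m+[n∸m] m n)

m∸n≡1⇒m≡1+n : ∀ m n → m ∸ n ≡ 1 → m ≡ suc n
m∸n≡1⇒m≡1+n (suc zero) zero refl = refl
m∸n≡1⇒m≡1+n (suc m) (suc n) e = cong suc (m∸n≡1⇒m≡1+n m n e)

p+[q+r]≡1-split : ∀ p q r → p + (q + r) ≡ 1 →
                  (p ≡ 1 × q ≡ 0 × r ≡ 0) ⊎ (p ≡ 0 × q ≡ 1 × r ≡ 0) ⊎ (p ≡ 0 × q ≡ 0 × r ≡ 1)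
p+[q+r]≡1-split 1 0 0 refl = inj₁ (refl , refl , refl)
p+[q+r]≡1-split 0 1 0 refl = inj₂ (inj₁ (refl , refl , refl))
p+[q+r]≡1-split 0 0 1 refl = inj₂ (inj₂ (refl , refl , refl))
p+[q+r]≡1-split 0 0 (suc (suc r)) ()
p+[q+r]≡1-split 0 (suc zero) (suc r) ()
p+[q+r]≡1-split 0 (suc (suc q)) r ()
p+[q+r]≡1-split (suc zero) (suc q) r ()
p+[q+r]≡1-split (suc zero) zero (suc r) ()
p+[q+r]≡1-split (suc (suc p)) q r ()

one-coordinate-drops : ∀ b c y z → y ≤ b → z ≤ c → b + (c + 0) ≡ suc (y + (z + 0)) →
                       (b ≡ suc y × c ≡ z) ⊎ (b ≡ y × c ≡ suc z)
one-coordinate-drops b c y z y≤b z≤c e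
  rewrite +-identityʳ c | +-identityʳ z with y ≟ b
... | yes refl = inj₂ (refl , +-cancelˡ-≡ y _ _ (trans e (sym (+-suc y z))))
... | no y≢b = inj₁ (+-cancelʳ-≡ z _ _ (trans (cong (b +_) (sym c≡z)) e) , c≡z)
  where
    c≡z : c ≡ z
    c≡z = ≤-antisym (+-cancelˡ-≤ b c z (≤-trans (≤-reflexive e) (+-monoˡ-≤ z (≤∧≢⇒< y≤b y≢b)))) z≤c

infix 4 _≡₃_

_≡₃_ : ℕ → ℕ → Set
m ≡₃ n = m % 3 ≡ n % 3

1+n≢₃n : ∀ n → ¬ suc n ≡₃ n
1+n≢₃n 0 ()
1+n≢₃n 1 ()
1+n≢₃n 2 ()
1+n≢₃n (suc (suc (suc n))) = 1+n≢₃n n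

[k+n%3]%3≡[k+n]%3 : ∀ k n → (k + n % 3) % 3 ≡ (k + n) % 3
[k+n%3]%3≡[k+n]%3 k n = begin
  (k + n % 3) % 3         ≡⟨ %-distribˡ-+ k (n % 3) 3 ⟩
  (k % 3 + n % 3 % 3) % 3 ≡⟨ cong (λ r → (k % 3 + r) % 3) (m%n%n≡m%n n 3) ⟩
  (k % 3 + n % 3) % 3     ≡⟨ %-distribˡ-+ k n 3 ⟨
  (k + n) % 3             ∎
  where open ≡-Reasoning

≡₃-suc : ∀ m n → m ≡₃ n → suc m ≡₃ suc n
≡₃-suc m n e =
  trans (sym ([k+n%3]%3≡[k+n]%3 1 m)) (trans (cong (λ r → (1 + r) % 3) e) ([k+n%3]%3≡[k+n]%3 1 n))

sum-map-++ : ∀ {A : Set} (f : A → ℕ) xs ys → sum (map f (xs ++ ys)) ≡ sum (map f xs) + sum (map f ys)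
sum-map-++ f xs ys = trans (cong sum (map-++ f xs ys)) (sum-++ (map f xs) (map f ys))

sum-⊆ : ∀ {A : Set} (f : A → ℕ) {xs ys} → Unique xs → (∀ {x} → x ∈ xs → x ∈ ys) →
        sum (map f xs) ≤ sum (map f ys)
sum-⊆ f {[]} _ _ = z≤n
sum-⊆ f {x ∷ xs} {ys} (x∉xs ∷ xs-unique) xs⊆ys with ∈-∃++ (xs⊆ys (here refl))
... | ys₁ , ys₂ , refl = begin
  f x + sum (map f xs)                     ≤⟨ +-monoʳ-≤ (f x) (sum-⊆ f xs-unique xs⊆ys₁++ys₂) ⟩
  f x + sum (map f (ys₁ ++ ys₂))           ≡⟨ cong (f x +_) (sum-map-++ f ys₁ ys₂) ⟩
  f x + (sum (map f ys₁) + sum (map f ys₂)) ≡⟨ +-exchange (f x) (sum (map f ys₁)) _ ⟩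
  sum (map f ys₁) + (f x + sum (map f ys₂)) ≡⟨ sum-map-++ f ys₁ (x ∷ ys₂) ⟨
  sum (map f (ys₁ ++ x ∷ ys₂))             ∎
  where
    open ≤-Reasoning
    +-exchange : ∀ a b c → a + (b + c) ≡ b + (a + c)
    +-exchange = solve-∀
    xs⊆ys₁++ys₂ : ∀ {y} → y ∈ xs → y ∈ ys₁ ++ ys₂
    xs⊆ys₁++ys₂ {y} y∈xs with ∈-++⁻ ys₁ (xs⊆ys (there y∈xs))
    ... | inj₁ y∈ys₁ = ∈-++⁺ˡ y∈ys₁
    ... | inj₂ (here refl) = ⊥-elim (All.lookup x∉xs y∈xs refl)
    ... | inj₂ (there y∈ys₂) = ∈-++⁺ʳ ys₁ y∈ys₂

sum-map-≥ : ∀ {A : Set} (f : A → ℕ) N xs → (∀ {x} → x ∈ xs → N ≤ f x) → N * length xs ≤ sum (map f xs)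
sum-map-≥ f N [] _ = ≤-reflexive (*-zeroʳ N)
sum-map-≥ f N (x ∷ xs) bound =
  ≤-trans (≤-reflexive (*-suc N (length xs))) (+-mono-≤ (bound (here refl)) (sum-map-≥ f N xs (bound ∘ there)))

sum-map-> : ∀ {A : Set} (f : A → ℕ) N {x₀} xs → x₀ ∈ xs → N < f x₀ → (∀ {x} → x ∈ xs → N ≤ f x) →
            N * length xs < sum (map f xs)
sum-map-> f N (x ∷ xs) (here refl) N<fx bound =
  ≤-trans (s≤s (≤-reflexive (*-suc N (length xs)))) (+-mono-≤ N<fx (sum-map-≥ f N xs (bound ∘ there)))
sum-map-> f N (x ∷ xs) (there x₀∈xs) N<fx₀ bound =
  ≤-trans (≤-reflexive (cong suc (*-suc N (length xs))))
    (≤-trans (≤-reflexive (sym (+-suc N (N * length xs))))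
      (+-mono-≤ (bound (here refl)) (sum-map-> f N xs x₀∈xs N<fx₀ (bound ∘ there))))

∈-replicate⁻ : ∀ {A : Set} {x y : A} n → x ∈ replicate n y → x ≡ y × 1 ≤ n
∈-replicate⁻ (suc n) (here x≡y) = x≡y , s≤s z≤n
∈-replicate⁻ (suc n) (there x∈) = proj₁ (∈-replicate⁻ n x∈) , s≤s z≤n

∈-replicate⁺ : ∀ {A : Set} {x : A} n → 1 ≤ n → x ∈ replicate n x
∈-replicate⁺ (suc n) _ = here refl

length-replicates : ∀ {A B : Set} (f : B → ℕ) (g : B → A) bs →
                    length (concatMap (λ b → replicate (f b) (g b)) bs) ≡ sum (map f bs)
length-replicates f g [] = refl
length-replicates f g (b ∷ bs) =
  trans (length-++ (replicate (f b) (g b))) (cong₂ _+_ (length-replicate (f b)) (length-replicates f g bs))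

sum-map-const : ∀ {A : Set} (f : A → ℕ) N xs → (∀ {x} → x ∈ xs → f x ≡ N) → sum (map f xs) ≡ N * length xs
sum-map-const f N [] _ = sym (*-zeroʳ N)
sum-map-const f N (x ∷ xs) const =
  trans (cong₂ _+_ (const (here refl)) (sum-map-const f N xs (const ∘ there))) (sym (*-suc N (length xs)))

sum-if-≤-filter : ∀ {A : Set} (P : A → Bool) (f g : A → ℕ) xs → (∀ {x} → T (P x) → f x ≤ g x) →
                  sum (map (λ x → if P x then f x else 0) xs) ≤ sum (map g (filter (T? ∘ P) xs))
sum-if-≤-filter P f g [] _ = z≤n
sum-if-≤-filter P f g (x ∷ xs) f≤g with P x in eq
... | true = +-mono-≤ (f≤g (subst T (sym eq) tt)) (sum-if-≤-filter P f g xs f≤g)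
... | false = sum-if-≤-filter P f g xs f≤g

sum-if-positive : ∀ {A : Set} (P : A → Bool) (f : A → ℕ) xs →
                  0 < sum (map (λ x → if P x then f x else 0) xs) → ∃ λ x → T (P x)
sum-if-positive P f (x ∷ xs) positive with P x in eq
... | true = x , subst T (sym eq) tt
... | false = sum-if-positive P f xs positive

unique-map : ∀ {A B : Set} (f : A → B) {xs} → (∀ {x y} → x ∈ xs → y ∈ xs → f x ≡ f y → x ≡ y) →
             Unique xs → Unique (map f xs)
unique-map f {[]} _ [] = []
unique-map f {x ∷ xs} injective (x∉xs ∷ xs-unique) =
  AllP.map⁺ (All.tabulate λ y∈xs fx≡fy → All.lookup x∉xs y∈xs (injective (here refl) (there y∈xs) fx≡fy))
  ∷ unique-map f (λ x∈ y∈ → injective (there x∈) (there y∈)) xs-unique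

∈-concatMap⁻ : ∀ {A B : Set} {y : B} (f : A → List B) xs → y ∈ concatMap f xs → ∃ λ x → x ∈ xs × y ∈ f x
∈-concatMap⁻ f xs y∈ = find (Any.concatMap⁻ f y∈)

∈-concatMap⁺ : ∀ {A B : Set} {x : A} {y : B} (f : A → List B) {xs} → x ∈ xs → y ∈ f x → y ∈ concatMap f xs
∈-concatMap⁺ f x∈xs y∈fx = Any.concatMap⁺ f (lose x∈xs y∈fx)

length-concatMap : ∀ {A B : Set} (f : A → List B) xs → length (concatMap f xs) ≡ sum (map (length ∘ f) xs)
length-concatMap f [] = refl
length-concatMap f (x ∷ xs) = trans (length-++ (f x)) (cong (length (f x) +_) (length-concatMap f xs))

module Incidence {A : Set} (_≟_ : DecidableEquality A) where

  open import Data.List.Membership.DecPropositional _≟_ using (_∈?_)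

  indicator : ∀ {P : Set} → Dec P → ℕ
  indicator (yes _) = 1
  indicator (no _) = 0

  multiplicity : A → List (List A) → ℕ
  multiplicity x [] = 0
  multiplicity x (K ∷ L) = indicator (x ∈? K) + multiplicity x L

  hits : List A → List A → ℕ
  hits [] K = 0
  hits (x ∷ I) K = indicator (x ∈? K) + hits I K

  incidences : List A → List (List A) → ℕ
  incidences I L = sum (map (λ x → multiplicity x L) I)

  multiplicity-++ : ∀ x L L′ → multiplicity x (L ++ L′) ≡ multiplicity x L + multiplicity x L′
  multiplicity-++ x [] L′ = refl
  multiplicity-++ x (K ∷ L) L′ =
    trans (cong (indicator (x ∈? K) +_) (multiplicity-++ x L L′)) (sym (+-assoc (indicator (x ∈? K)) _ _))

  multiplicity-replicate : ∀ {x K} n → x ∈ K → multiplicity x (replicate n K) ≡ n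
  multiplicity-replicate {x} {K} zero x∈K = refl
  multiplicity-replicate {x} {K} (suc n) x∈K with x ∈? K
  ... | yes _ = cong suc (multiplicity-replicate n x∈K)
  ... | no x∉K = ⊥-elim (x∉K x∈K)

  multiplicity-concatMap : ∀ {B : Set} x (g : B → List (List A)) bs →
                           multiplicity x (concatMap g bs) ≡ sum (map (λ b → multiplicity x (g b)) bs)
  multiplicity-concatMap x g [] = refl
  multiplicity-concatMap x g (b ∷ bs) =
    trans (multiplicity-++ x (g b) (concatMap g bs)) (cong (multiplicity x (g b) +_) (multiplicity-concatMap x g bs))

  incidences-∷ : ∀ I K L → incidences I (K ∷ L) ≡ hits I K + incidences I L
  incidences-∷ [] K L = refl
  incidences-∷ (x ∷ I) K L =
    trans (cong (indicator (x ∈? K) + multiplicity x L +_) (incidences-∷ I K L))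
          (interchange (indicator (x ∈? K)) (multiplicity x L) (hits I K) (incidences I L))
    where interchange : ∀ p q r s → p + q + (r + s) ≡ p + r + (q + s)
          interchange = solve-∀

  hits-disjoint : ∀ I K → (∀ {x} → x ∈ I → x ∉ K) → hits I K ≡ 0
  hits-disjoint [] K _ = refl
  hits-disjoint (x ∷ I) K disjoint with x ∈? K
  ... | yes x∈K = ⊥-elim (disjoint (here refl) x∈K)
  ... | no _ = hits-disjoint I K (λ y∈I → disjoint (there y∈I))

  multiplicity-replicates : ∀ {B : Set} x (f : B → ℕ) (g : B → List A) (selected : B → Bool) bs →
    (∀ {b} → T (selected b) → x ∈ g b) →
    sum (map (λ b → if selected b then f b else 0) bs) ≤ multiplicity x (concatMap (λ b → replicate (f b) (g b)) bs)
  multiplicity-replicates x f g selected [] _ = z≤n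
  multiplicity-replicates x f g selected (b ∷ bs) sound =
    ≤-trans (+-mono-≤ here-bound (multiplicity-replicates x f g selected bs sound))
            (≤-reflexive (sym (multiplicity-++ x (replicate (f b) (g b)) _)))
    where
      here-bound : (if selected b then f b else 0) ≤ multiplicity x (replicate (f b) (g b))
      here-bound with selected b in eq
      ... | true = ≤-reflexive (sym (multiplicity-replicate (f b) (sound (subst T (sym eq) _))))
      ... | false = z≤n

  module _ (_~_ : A → A → Set) where

    Clique : List A → Set
    Clique K = ∀ {x y} → x ∈ K → y ∈ K → x ≡ y ⊎ x ~ y

    Independent : List A → Set
    Independent I = ∀ {x y} → x ∈ I → y ∈ I → ¬ x ~ y

    hits-clique : ∀ I K → Unique I → Independent I → Clique K → hits I K ≤ 1
    hits-clique [] K _ _ _ = z≤n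
    hits-clique (x ∷ I) K (x∉I ∷ I-unique) I-indep K-clique with x ∈? K
    ... | no _ = hits-clique I K I-unique (λ p q → I-indep (there p) (there q)) K-clique
    ... | yes x∈K = ≤-reflexive (cong suc (hits-disjoint I K others-miss))
      where
        others-miss : ∀ {y} → y ∈ I → y ∉ K
        others-miss y∈I y∈K with K-clique x∈K y∈K
        ... | inj₁ x≡y = All.lookup x∉I y∈I x≡y
        ... | inj₂ x~y = I-indep (here refl) (there y∈I) x~y

    incidences-≤ : ∀ I L → Unique I → Independent I → (∀ {K} → K ∈ L → Clique K) → incidences I L ≤ length L
    incidences-≤ I [] _ _ _ = ≤-reflexive (sum-zeros I)
      where sum-zeros : ∀ I → incidences I [] ≡ 0
            sum-zeros [] = refl
            sum-zeros (_ ∷ I) = sum-zeros I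
    incidences-≤ I (K ∷ L) I-unique I-indep cliques rewrite incidences-∷ I K L =
      +-mono-≤ (hits-clique I K I-unique I-indep (cliques (here refl)))
               (incidences-≤ I L I-unique I-indep (λ K∈L → cliques (there K∈L)))

    incidences-< : ∀ I L {K} → Unique I → Independent I → (∀ {K} → K ∈ L → Clique K) →
                   K ∈ L → (∀ {x} → x ∈ I → x ∉ K) → incidences I L < length L
    incidences-< I (K ∷ L) I-unique I-indep cliques (here refl) missed
      rewrite incidences-∷ I K L | hits-disjoint I K missed =
      s≤s (incidences-≤ I L I-unique I-indep (λ K∈L → cliques (there K∈L)))
    incidences-< I (K′ ∷ L) I-unique I-indep cliques (there K∈L) missed rewrite incidences-∷ I K′ L =
      ≤-trans (≤-reflexive (sym (+-suc (hits I K′) (incidences I L))))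
              (+-mono-≤ (hits-clique I K′ I-unique I-indep (cliques (here refl)))
                        (incidences-< I L I-unique I-indep (λ K∈L → cliques (there K∈L)) K∈L missed))

pattern ⟨_,_,_⟩ a b c = a ∷ b ∷ c ∷ []

Point : Set
Point = Monomial 3

_≟ₚ_ : DecidableEquality Point
_≟ₚ_ = Vec.≡-dec _≟_

open Incidence _≟ₚ_
open import Data.List.Membership.DecPropositional _≟ₚ_ using (_∈?_)

data Step : Point → Point → Set where
  a↦b : ∀ {a b c} → Step ⟨ suc a , b , c ⟩ ⟨ a , suc b , c ⟩
  a↦c : ∀ {a b c} → Step ⟨ suc a , b , c ⟩ ⟨ a , b , suc c ⟩
  b↦a : ∀ {a b c} → Step ⟨ a , suc b , c ⟩ ⟨ suc a , b , c ⟩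
  b↦c : ∀ {a b c} → Step ⟨ a , suc b , c ⟩ ⟨ a , b , suc c ⟩
  c↦a : ∀ {a b c} → Step ⟨ a , b , suc c ⟩ ⟨ suc a , b , c ⟩
  c↦b : ∀ {a b c} → Step ⟨ a , b , suc c ⟩ ⟨ a , suc b , c ⟩

step-sym : ∀ {u w} → Step u w → Step w u
step-sym a↦b = b↦a
step-sym a↦c = c↦a
step-sym b↦a = a↦b
step-sym b↦c = c↦b
step-sym c↦a = a↦c
step-sym c↦b = b↦c

deg-step : ∀ {u w} → Step u w → deg u ≡ deg w
deg-step (a↦b {a}) = sym (+-suc a _)
deg-step (a↦c {a} {b}) = sym (trans (cong (a +_) (+-suc b _)) (+-suc a _))
deg-step (b↦c {a} {b}) = cong (a +_) (sym (+-suc b _))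
deg-step s@b↦a = sym (deg-step (step-sym s))
deg-step s@c↦a = sym (deg-step (step-sym s))
deg-step s@c↦b = sym (deg-step (step-sym s))

lcm-comm : ∀ {n} (u w : Monomial n) → lcm u w ≡ lcm w u
lcm-comm = Vec.zipWith-comm ⊔-comm

deg-lcm-reverse : ∀ (u w : Point) → deg u ≡ deg w → deg (lcm w u) ≡ suc (deg w) → deg (lcm u w) ≡ suc (deg u)
deg-lcm-reverse u w u≡w e = trans (cong deg (lcm-comm u w)) (trans e (cong suc (sym u≡w)))

deg-lcm-step : ∀ {u w} → Step u w → deg (lcm u w) ≡ suc (deg u)
deg-lcm-step (a↦b {a} {b} {c}) rewrite 1+n⊔n≡1+n a | n⊔1+n≡1+n b | ⊔-idem c = cong suc (+-suc a _)
deg-lcm-step (a↦c {a} {b} {c}) rewrite 1+n⊔n≡1+n a | ⊔-idem b | n⊔1+n≡1+n c =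
  cong suc (trans (cong (a +_) (+-suc b _)) (+-suc a _))
deg-lcm-step (b↦c {a} {b} {c}) rewrite ⊔-idem a | 1+n⊔n≡1+n b | n⊔1+n≡1+n c =
  trans (cong (a +_) (cong suc (+-suc b _))) (+-suc a _)
deg-lcm-step {u} {w} s@b↦a = deg-lcm-reverse u w (deg-step s) (deg-lcm-step (step-sym s))
deg-lcm-step {u} {w} s@c↦a = deg-lcm-reverse u w (deg-step s) (deg-lcm-step (step-sym s))
deg-lcm-step {u} {w} s@c↦b = deg-lcm-reverse u w (deg-step s) (deg-lcm-step (step-sym s))

step⇒adj : ∀ {d u w} → deg u ≡ d → Step u w → Adj 3 d u w
step⇒adj refl = deg-lcm-step

deg-lcm-excess : ∀ a b c x y z →
  deg (lcm ⟨ a , b , c ⟩ ⟨ x , y , z ⟩) ≡ deg ⟨ a , b , c ⟩ + ((x ∸ a) + ((y ∸ b) + (z ∸ c)))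
deg-lcm-excess a b c x y z rewrite m⊔n≡m+[n∸m] a x | m⊔n≡m+[n∸m] b y | m⊔n≡m+[n∸m] c z = shuffle a b c (x ∸ a) (y ∸ b) (z ∸ c)
  where shuffle : ∀ a b c p q r → a + p + (b + q + (c + r + 0)) ≡ a + (b + (c + 0)) + (p + (q + r))
        shuffle = solve-∀

adj⇒step : ∀ {u w} → deg u ≡ deg w → deg (lcm u w) ≡ suc (deg u) → Step u w
adj⇒step {⟨ a , b , c ⟩} {⟨ x , y , z ⟩} u≡w adj with p+[q+r]≡1-split (x ∸ a) (y ∸ b) (z ∸ c) excess≡1
  where
    excess≡1 : (x ∸ a) + ((y ∸ b) + (z ∸ c)) ≡ 1
    excess≡1 = +-cancelˡ-≡ (deg ⟨ a , b , c ⟩) _ _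
                 (trans (sym (deg-lcm-excess a b c x y z)) (trans adj (+-comm 1 _)))
... | inj₁ (up , y∸b≡0 , z∸c≡0) with m∸n≡1⇒m≡1+n x a up
...   | refl with one-coordinate-drops b c y z (m∸n≡0⇒m≤n y∸b≡0) (m∸n≡0⇒m≤n z∸c≡0)
                   (+-cancelˡ-≡ a _ _ (trans u≡w (sym (+-suc a _))))
...     | inj₁ (refl , refl) = b↦a
...     | inj₂ (refl , refl) = c↦a
adj⇒step {⟨ a , b , c ⟩} {⟨ x , y , z ⟩} u≡w adj | inj₂ (inj₁ (x∸a≡0 , up , z∸c≡0)) with m∸n≡1⇒m≡1+n y b up
...   | refl with one-coordinate-drops a c x z (m∸n≡0⇒m≤n x∸a≡0) (m∸n≡0⇒m≤n z∸c≡0)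
                   (+-cancelˡ-≡ b _ _ (trans (swap₁ a b c) (trans u≡w (swap₂ x b z))))
  where
    swap₁ : ∀ a b c → b + (a + (c + 0)) ≡ a + (b + (c + 0))
    swap₁ = solve-∀
    swap₂ : ∀ x b z → x + (suc b + (z + 0)) ≡ b + suc (x + (z + 0))
    swap₂ = solve-∀
...     | inj₁ (refl , refl) = a↦b
...     | inj₂ (refl , refl) = c↦b
adj⇒step {⟨ a , b , c ⟩} {⟨ x , y , z ⟩} u≡w adj | inj₂ (inj₂ (x∸a≡0 , y∸b≡0 , up)) with m∸n≡1⇒m≡1+n z c up
...   | refl with one-coordinate-drops a b x y (m∸n≡0⇒m≤n x∸a≡0) (m∸n≡0⇒m≤n y∸b≡0)
                   (+-cancelˡ-≡ c _ _ (trans (swap₁ a b c) (trans u≡w (swap₂ x y c))))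
  where
    swap₁ : ∀ a b c → c + (a + (b + 0)) ≡ a + (b + (c + 0))
    swap₁ = solve-∀
    swap₂ : ∀ x y c → x + (y + (suc c + 0)) ≡ c + suc (x + (y + 0))
    swap₂ = solve-∀
...     | inj₁ (refl , refl) = a↦c
...     | inj₂ (refl , refl) = b↦c

Congruent : Point → Set
Congruent ⟨ a , b , c ⟩ = a ≡₃ b × a ≡₃ c

step-breaks-congruence : ∀ {u w} → Step u w → Congruent u → ¬ Congruent w
step-breaks-congruence (a↦b {a}) (_ , ac) (_ , ac′) = 1+n≢₃n a (trans ac (sym ac′))
step-breaks-congruence (a↦c {a}) (ab , _) (ab′ , _) = 1+n≢₃n a (trans ab (sym ab′))
step-breaks-congruence (b↦a {b = b}) (ab , ac) (ab′ , ac′) =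
  1+n≢₃n b (trans (trans (sym ab) ac) (sym (trans (sym ab′) ac′)))
step-breaks-congruence (b↦c {b = b}) (ab , _) (ab′ , _) = 1+n≢₃n b (trans (sym ab) ab′)
step-breaks-congruence (c↦a {c = c}) (ab , ac) (ab′ , ac′) =
  1+n≢₃n c (trans (trans (sym ac) ab) (sym (trans (sym ac′) ab′)))
step-breaks-congruence (c↦b {c = c}) (_ , ac) (_ , ac′) = 1+n≢₃n c (trans (sym ac) ac′)

congruent-independent : ∀ {d u w} → Congruent u → Congruent w → deg u ≡ d → deg w ≡ d → ¬ Adj 3 d u w
congruent-independent cu cw refl dw adj = step-breaks-congruence (adj⇒step (sym dw) adj) cu cw

box : ℕ → List Point
box n = cartesianProductWith _∷_ (upTo n) (cartesianProductWith (λ b c → b ∷ c ∷ []) (upTo n) (upTo n))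

box-unique : ∀ n → Unique (box n)
box-unique n = Unique.cartesianProductWith⁺ _∷_ Vec.∷-injective (Unique.upTo⁺ n)
                 (Unique.cartesianProductWith⁺ _ ∷∷-injective (Unique.upTo⁺ n) (Unique.upTo⁺ n))
  where
    ∷∷-injective : ∀ {b b′ c c′ : ℕ} → b ∷ c ∷ [] ≡ b′ ∷ c′ ∷ [] → b ≡ b′ × c ≡ c′
    ∷∷-injective refl = refl , refl

∈-box : ∀ {n a b c} → a < n → b < n → c < n → ⟨ a , b , c ⟩ ∈ box n
∈-box a<n b<n c<n =
  ∈-cartesianProductWith⁺ _∷_ (∈-upTo⁺ a<n) (∈-cartesianProductWith⁺ _ (∈-upTo⁺ b<n) (∈-upTo⁺ c<n))

simplex : ℕ → List Point
simplex d = filter (λ p → deg p ≟ d) (box (suc d))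

simplex-unique : ∀ d → Unique (simplex d)
simplex-unique d = Unique.filter⁺ (λ p → deg p ≟ d) (box-unique (suc d))

∈-simplex⁻ : ∀ {d p} → p ∈ simplex d → deg p ≡ d
∈-simplex⁻ {d} p∈ = proj₂ (∈-filter⁻ (λ p → deg p ≟ d) {xs = box (suc d)} p∈)

∈-simplex⁺ : ∀ {d p} → deg p ≡ d → p ∈ simplex d
∈-simplex⁺ {d} {⟨ a , b , c ⟩} refl = ∈-filter⁺ (λ p → deg p ≟ d) (∈-box (s≤s a≤) (s≤s b≤) (s≤s c≤)) refl
  where
    a≤ : a ≤ deg ⟨ a , b , c ⟩
    a≤ = m≤m+n a _
    b≤ : b ≤ deg ⟨ a , b , c ⟩
    b≤ = ≤-trans (m≤m+n b _) (m≤n+m _ a)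
    c≤ : c ≤ deg ⟨ a , b , c ⟩
    c≤ = ≤-trans (≤-trans (m≤m+n c 0) (m≤n+m _ b)) (m≤n+m _ a)

congruent? : Decidable Congruent
congruent? ⟨ a , b , c ⟩ = (a % 3 ≟ b % 3) ×-dec (a % 3 ≟ c % 3)

congruentPoints : ℕ → List Point
congruentPoints d = filter congruent? (simplex d)

congruentPoints-unique : ∀ d → Unique (congruentPoints d)
congruentPoints-unique d = Unique.filter⁺ congruent? (simplex-unique d)

∈-congruentPoints⁻ : ∀ {d p} → p ∈ congruentPoints d → deg p ≡ d × Congruent p
∈-congruentPoints⁻ {d} p∈ with ∈-filter⁻ congruent? {xs = simplex d} p∈
... | p∈simplex , cp = ∈-simplex⁻ p∈simplex , cp

∈-congruentPoints⁺ : ∀ {d p} → deg p ≡ d → Congruent p → p ∈ congruentPoints d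
∈-congruentPoints⁺ dp cp = ∈-filter⁺ congruent? (∈-simplex⁺ dp) cp

data Move : Set where
  a↦b a↦c b↦a b↦c c↦a c↦b : Move

allMoves : List Move
allMoves = a↦b ∷ a↦c ∷ b↦a ∷ b↦c ∷ c↦a ∷ c↦b ∷ []

∈-allMoves : ∀ m → m ∈ allMoves
∈-allMoves a↦b = here refl
∈-allMoves a↦c = there (here refl)
∈-allMoves b↦a = there (there (here refl))
∈-allMoves b↦c = there (there (there (here refl)))
∈-allMoves c↦a = there (there (there (there (here refl))))
∈-allMoves c↦b = there (there (there (there (there (here refl)))))

allMoves-unique : Unique allMoves
allMoves-unique =
  ((λ ()) ∷ (λ ()) ∷ (λ ()) ∷ (λ ()) ∷ (λ ()) ∷ []) ∷ ((λ ()) ∷ (λ ()) ∷ (λ ()) ∷ (λ ()) ∷ []) ∷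
  ((λ ()) ∷ (λ ()) ∷ (λ ()) ∷ []) ∷ ((λ ()) ∷ (λ ()) ∷ []) ∷ ((λ ()) ∷ []) ∷ [] ∷ []

opposite : Move → Move
opposite a↦b = b↦a
opposite a↦c = c↦a
opposite b↦a = a↦b
opposite b↦c = c↦b
opposite c↦a = a↦c
opposite c↦b = b↦c

-- A junk point (pred 0 = 0) unless movable m p holds.
move : Move → Point → Point
move a↦b ⟨ a , b , c ⟩ = ⟨ pred a , suc b , c ⟩
move a↦c ⟨ a , b , c ⟩ = ⟨ pred a , b , suc c ⟩
move b↦a ⟨ a , b , c ⟩ = ⟨ suc a , pred b , c ⟩
move b↦c ⟨ a , b , c ⟩ = ⟨ a , pred b , suc c ⟩
move c↦a ⟨ a , b , c ⟩ = ⟨ suc a , b , pred c ⟩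
move c↦b ⟨ a , b , c ⟩ = ⟨ a , suc b , pred c ⟩

positive : ℕ → Bool
positive zero = false
positive (suc _) = true

movable : Move → Point → Bool
movable a↦b ⟨ a , _ , _ ⟩ = positive a
movable a↦c ⟨ a , _ , _ ⟩ = positive a
movable b↦a ⟨ _ , b , _ ⟩ = positive b
movable b↦c ⟨ _ , b , _ ⟩ = positive b
movable c↦a ⟨ _ , _ , c ⟩ = positive c
movable c↦b ⟨ _ , _ , c ⟩ = positive c

step-move : ∀ m {q} → T (movable m q) → Step q (move m q)
step-move a↦b {⟨ suc a , b , c ⟩} _ = a↦b
step-move a↦c {⟨ suc a , b , c ⟩} _ = a↦c
step-move b↦a {⟨ a , suc b , c ⟩} _ = b↦a
step-move b↦c {⟨ a , suc b , c ⟩} _ = b↦c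
step-move c↦a {⟨ a , b , suc c ⟩} _ = c↦a
step-move c↦b {⟨ a , b , suc c ⟩} _ = c↦b

move-opposite : ∀ m {q} → T (movable m q) → move (opposite m) (move m q) ≡ q
move-opposite a↦b {⟨ suc a , b , c ⟩} _ = refl
move-opposite a↦c {⟨ suc a , b , c ⟩} _ = refl
move-opposite b↦a {⟨ a , suc b , c ⟩} _ = refl
move-opposite b↦c {⟨ a , suc b , c ⟩} _ = refl
move-opposite c↦a {⟨ a , b , suc c ⟩} _ = refl
move-opposite c↦b {⟨ a , b , suc c ⟩} _ = refl

moveOf : ∀ {u w} → Step u w → Move
moveOf a↦b = a↦b
moveOf a↦c = a↦c
moveOf b↦a = b↦a
moveOf b↦c = b↦c
moveOf c↦a = c↦a
moveOf c↦b = c↦b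

moveOf-step-move : ∀ m {q} (ok : T (movable m q)) → moveOf (step-move m ok) ≡ m
moveOf-step-move a↦b {⟨ suc a , b , c ⟩} _ = refl
moveOf-step-move a↦c {⟨ suc a , b , c ⟩} _ = refl
moveOf-step-move b↦a {⟨ a , suc b , c ⟩} _ = refl
moveOf-step-move b↦c {⟨ a , suc b , c ⟩} _ = refl
moveOf-step-move c↦a {⟨ a , b , suc c ⟩} _ = refl
moveOf-step-move c↦b {⟨ a , b , suc c ⟩} _ = refl

steps-agree : ∀ {u w w′} (s : Step u w) (s′ : Step u w′) → w ≡ w′ → moveOf s ≡ moveOf s′
steps-agree a↦b a↦b refl = refl
steps-agree a↦c a↦c refl = refl
steps-agree b↦a b↦a refl = refl
steps-agree b↦c b↦c refl = refl
steps-agree c↦a c↦a refl = refl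
steps-agree c↦b c↦b refl = refl

move-injective : ∀ {m m′ q} → T (movable m q) → T (movable m′ q) → move m q ≡ move m′ q → m ≡ m′
move-injective {m} {m′} ok ok′ eq =
  trans (sym (moveOf-step-move m ok))
        (trans (steps-agree (step-move m ok) (step-move m′ ok′) eq) (moveOf-step-move m′ ok′))

data Shape : Set where
  U₀ U₁ U₂ D₀₁ D₀₂ D₁₂ : Shape

allShapes : List Shape
allShapes = U₀ ∷ U₁ ∷ U₂ ∷ D₀₁ ∷ D₀₂ ∷ D₁₂ ∷ []

∈-allShapes : ∀ s → s ∈ allShapes
∈-allShapes U₀ = here refl
∈-allShapes U₁ = there (here refl)
∈-allShapes U₂ = there (there (here refl))
∈-allShapes D₀₁ = there (there (there (here refl)))
∈-allShapes D₀₂ = there (there (there (there (here refl))))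
∈-allShapes D₁₂ = there (there (there (there (there (here refl)))))

hasCorner : Shape → Move → Bool
hasCorner U₀ a↦b = true
hasCorner U₀ a↦c = true
hasCorner U₁ b↦a = true
hasCorner U₁ b↦c = true
hasCorner U₂ c↦a = true
hasCorner U₂ c↦b = true
hasCorner D₀₁ a↦c = true
hasCorner D₀₁ b↦c = true
hasCorner D₀₂ a↦b = true
hasCorner D₀₂ c↦b = true
hasCorner D₁₂ b↦a = true
hasCorner D₁₂ c↦a = true
hasCorner _ _ = false

oppositeSide : Point → Shape → List Point
oppositeSide p s = map (λ m → move m p) (filter (λ m → T? (hasCorner s m)) allMoves)

triangle : Point → Shape → List Point
triangle p s = p ∷ oppositeSide p s

admissible : Shape → ℕ → ℕ → ℕ → Bool
admissible U₀ a b c = positive a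
admissible U₁ a b c = positive b
admissible U₂ a b c = positive c
admissible D₀₁ a b c = positive a ∧ positive b
admissible D₀₂ a b c = positive a ∧ positive c
admissible D₁₂ a b c = positive b ∧ positive c

byShape : ℕ → ℕ → ℕ → ℕ → ℕ → ℕ → Shape → ℕ
byShape w _ _ _ _ _ U₀ = w
byShape _ w _ _ _ _ U₁ = w
byShape _ _ w _ _ _ U₂ = w
byShape _ _ _ w _ _ D₀₁ = w
byShape _ _ _ _ w _ D₀₂ = w
byShape _ _ _ _ _ w D₁₂ = w

-- A fractional clique cover of weight |C|, scaled by 12: the weights of the six triangles at a
-- congruent point as a function of its coordinates capped at 4. The omitted triples are never the
-- capped coordinates of a congruent point other than the origin.
table : ℕ → ℕ → ℕ → Shape → ℕ
table 0 0 3 = byShape 0 0 12 0 0 0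
table 0 0 4 = byShape 0 0 12 0 0 0
table 0 3 0 = byShape 0 12 0 0 0 0
table 0 3 3 = byShape 0 0 0 0 0 12
table 0 3 4 = byShape 0 6 3 0 0 3
table 0 4 0 = byShape 0 12 0 0 0 0
table 0 4 3 = byShape 0 3 6 0 0 3
table 0 4 4 = byShape 0 3 3 0 0 6
table 1 1 1 = byShape 9 0 0 0 0 3
table 1 1 4 = byShape 0 0 0 0 6 6
table 1 4 1 = byShape 5 0 2 1 0 4
table 1 4 4 = byShape 9 0 0 0 0 3
table 2 2 2 = byShape 0 0 0 0 0 12
table 2 2 4 = byShape 1 0 2 0 5 4
table 2 4 2 = byShape 2 1 2 4 0 3
table 2 4 4 = byShape 0 1 2 3 3 3
table 3 0 0 = byShape 12 0 0 0 0 0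
table 3 0 3 = byShape 0 0 12 0 0 0
table 3 0 4 = byShape 6 0 6 0 0 0
table 3 3 0 = byShape 0 12 0 0 0 0
table 3 3 3 = byShape 1 2 2 1 3 3
table 3 3 4 = byShape 2 3 1 0 3 3
table 3 4 0 = byShape 6 6 0 0 0 0
table 3 4 3 = byShape 1 0 2 3 3 3
table 3 4 4 = byShape 2 1 1 2 3 3
table 4 0 0 = byShape 12 0 0 0 0 0
table 4 0 3 = byShape 5 0 7 0 0 0
table 4 0 4 = byShape 5 0 6 0 1 0
table 4 1 1 = byShape 0 3 4 2 0 3
table 4 1 4 = byShape 0 4 0 2 3 3
table 4 2 2 = byShape 0 0 1 4 4 3
table 4 2 4 = byShape 0 0 2 3 4 3
table 4 3 0 = byShape 4 8 0 0 0 0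
table 4 3 3 = byShape 0 2 2 2 3 3
table 4 3 4 = byShape 1 3 1 1 3 3
table 4 4 0 = byShape 4 6 0 2 0 0
table 4 4 1 = byShape 0 0 5 3 1 3
table 4 4 2 = byShape 1 1 0 4 3 3
table 4 4 3 = byShape 0 0 2 4 3 3
table 4 4 4 = byShape 1 1 1 3 3 3
table _ _ _ = byShape 0 0 0 0 0 0

weightAt : ℕ → ℕ → ℕ → Shape → ℕ
weightAt a b c s = if admissible s a b c then table a b c s else 0

weight : Point → Shape → ℕ
weight ⟨ a , b , c ⟩ = weightAt (a ⊓ 4) (b ⊓ 4) (c ⊓ 4)

totalWeight : Point → ℕ
totalWeight p = sum (map (weight p) allShapes)

block : Point → List (List Point)
block p = concatMap (λ s → replicate (weight p s) (triangle p s)) allShapes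

cover : ℕ → List (List Point)
cover d = concatMap block (congruentPoints d)

clique3 : ∀ {d x y z} → deg x ≡ d → Step x y → Step x z → Step y z → Clique (Adj 3 d) (x ∷ y ∷ z ∷ [])
clique3 {d} {x} {y} {z} dx xy xz yz = edge
  where
    dy : deg y ≡ d
    dy = trans (sym (deg-step xy)) dx
    dz : deg z ≡ d
    dz = trans (sym (deg-step xz)) dx
    edge : Clique (Adj 3 d) (x ∷ y ∷ z ∷ [])
    edge (here refl) (here refl) = inj₁ refl
    edge (here refl) (there (here refl)) = inj₂ (step⇒adj dx xy)
    edge (here refl) (there (there (here refl))) = inj₂ (step⇒adj dx xz)
    edge (there (here refl)) (here refl) = inj₂ (step⇒adj dy (step-sym xy))
    edge (there (here refl)) (there (here refl)) = inj₁ refl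
    edge (there (here refl)) (there (there (here refl))) = inj₂ (step⇒adj dy yz)
    edge (there (there (here refl))) (here refl) = inj₂ (step⇒adj dz (step-sym xz))
    edge (there (there (here refl))) (there (here refl)) = inj₂ (step⇒adj dz (step-sym yz))
    edge (there (there (here refl))) (there (there (here refl))) = inj₁ refl

weight-admissible : ∀ {a b c} s → 1 ≤ weight ⟨ a , b , c ⟩ s → T (admissible s (a ⊓ 4) (b ⊓ 4) (c ⊓ 4))
weight-admissible {a} {b} {c} s w with admissible s (a ⊓ 4) (b ⊓ 4) (c ⊓ 4)
... | true = _
... | false with () ← w

triangle-clique : ∀ {d a b c} s → T (admissible s (a ⊓ 4) (b ⊓ 4) (c ⊓ 4)) → deg ⟨ a , b , c ⟩ ≡ d →
                  Clique (Adj 3 d) (triangle ⟨ a , b , c ⟩ s)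
triangle-clique {a = suc _} U₀ _ e = clique3 e a↦b a↦c b↦c
triangle-clique {b = suc _} U₁ _ e = clique3 e b↦a b↦c a↦c
triangle-clique {c = suc _} U₂ _ e = clique3 e c↦a c↦b a↦b
triangle-clique {a = suc _} {suc _} D₀₁ _ e = clique3 e a↦c b↦c b↦a
triangle-clique {a = suc _} {c = suc _} D₀₂ _ e = clique3 e a↦b c↦b c↦a
triangle-clique {b = suc _} {suc _} D₁₂ _ e = clique3 e b↦a c↦a c↦b
triangle-clique {a = zero} U₀ ()
triangle-clique {b = zero} U₁ ()
triangle-clique {c = zero} U₂ ()
triangle-clique {a = zero} D₀₁ ()
triangle-clique {a = suc _} {zero} D₀₁ ()
triangle-clique {a = zero} D₀₂ ()
triangle-clique {a = suc _} {c = zero} D₀₂ ()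
triangle-clique {b = zero} D₁₂ ()
triangle-clique {b = suc _} {zero} D₁₂ ()

cover-cliques : ∀ {d K} → K ∈ cover d → Clique (Adj 3 d) K
cover-cliques {d} K∈ with ∈-concatMap⁻ block (congruentPoints d) K∈
... | p@(⟨ a , b , c ⟩) , p∈C , K∈block
  with ∈-concatMap⁻ (λ s → replicate (weight p s) (triangle p s)) allShapes K∈block
... | s , _ , K∈copies with ∈-replicate⁻ (weight p s) K∈copies
... | refl , positive-weight =
  triangle-clique s (weight-admissible s positive-weight) (proj₁ (∈-congruentPoints⁻ p∈C))

∈-cover : ∀ {d p} s → p ∈ congruentPoints d → 1 ≤ weight p s → triangle p s ∈ cover d
∈-cover {p = p} s p∈C w =
  ∈-concatMap⁺ block p∈C
    (∈-concatMap⁺ (λ s → replicate (weight p s) (triangle p s)) (∈-allShapes s) (∈-replicate⁺ (weight p s) w))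

length-cover : ∀ d → length (cover d) ≡ sum (map totalWeight (congruentPoints d))
length-cover d = trans (length-concatMap block (congruentPoints d))
                       (cong sum (map-cong (λ p → length-replicates (weight p) (triangle p) allShapes) (congruentPoints d)))

multiplicity-own-block : ∀ p → multiplicity p (block p) ≡ totalWeight p
multiplicity-own-block p =
  trans (multiplicity-concatMap p (λ s → replicate (weight p s) (triangle p s)) allShapes)
        (cong sum (map-cong (λ s → multiplicity-replicate {K = triangle p s} (weight p s) (here refl)) allShapes))

weightThrough : Point → Move → ℕ
weightThrough p m = sum (map (λ s → if hasCorner s m then weight p s else 0) allShapes)

weightThrough-≤ : ∀ p m → weightThrough p m ≤ multiplicity (move m p) (block p)
weightThrough-≤ p m = multiplicity-replicates (move m p) (weight p) (triangle p) (λ s → hasCorner s m) allShapes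
  (λ h → there (∈-map⁺ (λ m → move m p) (∈-filter⁺ (λ m → T? (hasCorner _ m)) (∈-allMoves m) h)))

neighbourly : Point → Move → Bool
neighbourly q m = movable m q ∧ isYes (congruent? (move m q))

contribution : Point → Move → ℕ
contribution q m = if neighbourly q m then weightThrough (move m q) (opposite m) else 0

coverage : Point → ℕ
coverage q = sum (map (contribution q) allMoves)

neighbourly-step : ∀ {q} m → T (neighbourly q m) → Step q (move m q) × Congruent (move m q)
neighbourly-step m h with Equivalence.to T-∧ h
... | ok , congruent = step-move m ok , toWitness {a? = congruent? (move m _)} congruent

neighbourlyMoves : Point → List Move
neighbourlyMoves q = filter (T? ∘ neighbourly q) allMoves

congruentNeighbours : Point → List Point
congruentNeighbours q = map (λ m → move m q) (neighbourlyMoves q)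

∈-neighbourlyMoves⁻ : ∀ {q m} → m ∈ neighbourlyMoves q → T (neighbourly q m)
∈-neighbourlyMoves⁻ {q} m∈ = proj₂ (∈-filter⁻ (T? ∘ neighbourly q) {xs = allMoves} m∈)

congruentNeighbours-unique : ∀ q → Unique (congruentNeighbours q)
congruentNeighbours-unique q =
  unique-map (λ m → move m q) (λ m∈ m′∈ → move-injective (movable-of m∈) (movable-of m′∈))
             (Unique.filter⁺ (T? ∘ neighbourly q) allMoves-unique)
  where
    movable-of : ∀ {m} → m ∈ neighbourlyMoves q → T (movable m q)
    movable-of = proj₁ ∘ Equivalence.to T-∧ ∘ ∈-neighbourlyMoves⁻

congruentNeighbours-⊆ : ∀ {d q p} → deg q ≡ d → p ∈ congruentNeighbours q → p ∈ congruentPoints d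
congruentNeighbours-⊆ {q = q} dq p∈ with ∈-map⁻ (λ m → move m q) p∈
... | m , m∈ , refl with neighbourly-step m (∈-neighbourlyMoves⁻ m∈)
... | step , congruent = ∈-congruentPoints⁺ (trans (sym (deg-step step)) dq) congruent

weightThrough-neighbour : ∀ {q} m → T (neighbourly q m) →
                          weightThrough (move m q) (opposite m) ≤ multiplicity q (block (move m q))
weightThrough-neighbour {q} m h =
  subst (λ x → weightThrough (move m q) (opposite m) ≤ multiplicity x (block (move m q)))
        (move-opposite m (proj₁ (Equivalence.to T-∧ h)))
        (weightThrough-≤ (move m q) (opposite m))

coverage-≤ : ∀ {d q} → deg q ≡ d → coverage q ≤ multiplicity q (cover d)
coverage-≤ {d} {q} dq = begin
  coverage q
    ≤⟨ sum-if-≤-filter (neighbourly q) (λ m → weightThrough (move m q) (opposite m))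
                       (λ m → multiplicity q (block (move m q))) allMoves (λ {m} → weightThrough-neighbour m) ⟩
  sum (map (λ m → multiplicity q (block (move m q))) (neighbourlyMoves q))
    ≡⟨ cong sum (map-∘ (neighbourlyMoves q)) ⟩
  sum (map (λ p → multiplicity q (block p)) (congruentNeighbours q))
    ≤⟨ sum-⊆ (λ p → multiplicity q (block p)) (congruentNeighbours-unique q) (congruentNeighbours-⊆ dq) ⟩
  sum (map (λ p → multiplicity q (block p)) (congruentPoints d))
    ≡⟨ multiplicity-concatMap q block (congruentPoints d) ⟨
  multiplicity q (cover d) ∎
  where open ≤-Reasoning

congruent-neighbour : ∀ q → 0 < coverage q → ∃ λ m → Step q (move m q) × Congruent (move m q)
congruent-neighbour q positive
  with sum-if-positive (neighbourly q) (λ m → weightThrough (move m q) (opposite m)) allMoves positive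
... | m , h = m , neighbourly-step m h

multiplicity-block-≤ : ∀ {d p} q → p ∈ congruentPoints d → multiplicity q (block p) ≤ multiplicity q (cover d)
multiplicity-block-≤ {d} {p} q p∈C = begin
  multiplicity q (block p)                                       ≡⟨ +-identityʳ _ ⟨
  multiplicity q (block p) + 0                                   ≤⟨ sum-⊆ (λ p → multiplicity q (block p)) ([] ∷ []) single ⟩
  sum (map (λ p → multiplicity q (block p)) (congruentPoints d)) ≡⟨ multiplicity-concatMap q block (congruentPoints d) ⟨
  multiplicity q (cover d)                                       ∎
  where
    open ≤-Reasoning
    single : ∀ {x} → x ∈ p ∷ [] → x ∈ congruentPoints d
    single (here refl) = p∈C

-- enc x has the same cap at 4 and the same residue mod 3 as x, and so have its successor and
-- predecessor; this is all the certificate sees, so checking the points of box 8 suffices.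
enc : ℕ → ℕ
enc 0 = 0
enc 1 = 1
enc 2 = 2
enc 3 = 3
enc 4 = 4
enc (suc (suc (suc (suc (suc n))))) = 5 + n % 3

encode : Point → Point
encode ⟨ a , b , c ⟩ = ⟨ enc a , enc b , enc c ⟩

enc<8 : ∀ x → enc x < 8
enc<8 0 = s≤s z≤n
enc<8 1 = s≤s (s≤s z≤n)
enc<8 2 = s≤s (s≤s (s≤s z≤n))
enc<8 3 = s≤s (s≤s (s≤s (s≤s z≤n)))
enc<8 4 = s≤s (s≤s (s≤s (s≤s (s≤s z≤n))))
enc<8 (suc (suc (suc (suc (suc n))))) = +-monoʳ-≤ 5 (m%n<n n 3)

enc<5 : ∀ x → enc x < 5 → enc x ≡ x
enc<5 0 _ = refl
enc<5 1 _ = refl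
enc<5 2 _ = refl
enc<5 3 _ = refl
enc<5 4 _ = refl
enc<5 (suc (suc (suc (suc (suc n))))) (s≤s (s≤s (s≤s (s≤s (s≤s ())))))

enc≡0 : ∀ x → enc x ≡ 0 → x ≡ 0
enc≡0 0 _ = refl
enc≡0 1 ()
enc≡0 2 ()
enc≡0 3 ()
enc≡0 4 ()
enc≡0 (suc (suc (suc (suc (suc n))))) ()

infix 4 _≈_ _≈ₚ_

_≈_ : ℕ → ℕ → Set
x ≈ y = x ⊓ 4 ≡ y ⊓ 4 × x ≡₃ y

enc-≈ : ∀ x → enc x ≈ x
enc-≈ 0 = refl , refl
enc-≈ 1 = refl , refl
enc-≈ 2 = refl , refl
enc-≈ 3 = refl , refl
enc-≈ 4 = refl , refl
enc-≈ (suc (suc (suc (suc (suc n))))) = refl , [k+n%3]%3≡[k+n]%3 5 n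

suc-enc-≈ : ∀ x → suc (enc x) ≈ suc x
suc-enc-≈ 0 = refl , refl
suc-enc-≈ 1 = refl , refl
suc-enc-≈ 2 = refl , refl
suc-enc-≈ 3 = refl , refl
suc-enc-≈ 4 = refl , refl
suc-enc-≈ (suc (suc (suc (suc (suc n))))) = refl , [k+n%3]%3≡[k+n]%3 6 n

pred-enc-≈ : ∀ x → pred (enc x) ≈ pred x
pred-enc-≈ 0 = refl , refl
pred-enc-≈ 1 = refl , refl
pred-enc-≈ 2 = refl , refl
pred-enc-≈ 3 = refl , refl
pred-enc-≈ 4 = refl , refl
pred-enc-≈ (suc (suc (suc (suc (suc n))))) = cong (4 +_) (trans (⊓-zeroʳ (n % 3)) (sym (⊓-zeroʳ n))) , [k+n%3]%3≡[k+n]%3 4 n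

_≈ₚ_ : Point → Point → Set
⟨ a , b , c ⟩ ≈ₚ ⟨ x , y , z ⟩ = a ≈ x × b ≈ y × c ≈ z

encode-≈ : ∀ q → encode q ≈ₚ q
encode-≈ ⟨ a , b , c ⟩ = enc-≈ a , enc-≈ b , enc-≈ c

move-encode-≈ : ∀ m q → move m (encode q) ≈ₚ move m q
move-encode-≈ a↦b ⟨ a , b , c ⟩ = pred-enc-≈ a , suc-enc-≈ b , enc-≈ c
move-encode-≈ a↦c ⟨ a , b , c ⟩ = pred-enc-≈ a , enc-≈ b , suc-enc-≈ c
move-encode-≈ b↦a ⟨ a , b , c ⟩ = suc-enc-≈ a , pred-enc-≈ b , enc-≈ c
move-encode-≈ b↦c ⟨ a , b , c ⟩ = enc-≈ a , pred-enc-≈ b , suc-enc-≈ c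
move-encode-≈ c↦a ⟨ a , b , c ⟩ = suc-enc-≈ a , enc-≈ b , pred-enc-≈ c
move-encode-≈ c↦b ⟨ a , b , c ⟩ = enc-≈ a , suc-enc-≈ b , pred-enc-≈ c

positive-≈ : ∀ {x y} → x ≈ y → positive x ≡ positive y
positive-≈ {x} {y} (x⊓4≡y⊓4 , _) = trans (sym (positive-⊓ x)) (trans (cong positive x⊓4≡y⊓4) (positive-⊓ y))
  where positive-⊓ : ∀ x → positive (x ⊓ 4) ≡ positive x
        positive-⊓ zero = refl
        positive-⊓ (suc x) = refl

weight-≈ : ∀ {u v} → u ≈ₚ v → ∀ s → weight u s ≡ weight v s
weight-≈ {⟨ a , b , c ⟩} {⟨ x , y , z ⟩} ((ax , _) , (by , _) , (cz , _)) s rewrite ax | by | cz = refl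

congruent-≈ : ∀ {u v} → u ≈ₚ v → isYes (congruent? u) ≡ isYes (congruent? v)
congruent-≈ {⟨ a , b , c ⟩} {⟨ x , y , z ⟩} ((_ , ax) , (_ , by) , (_ , cz)) rewrite ax | by | cz = refl

movable-≈ : ∀ {u v} → u ≈ₚ v → ∀ m → movable m u ≡ movable m v
movable-≈ {⟨ _ , _ , _ ⟩} {⟨ _ , _ , _ ⟩} (a≈x , _ , _) a↦b = positive-≈ a≈x
movable-≈ {⟨ _ , _ , _ ⟩} {⟨ _ , _ , _ ⟩} (a≈x , _ , _) a↦c = positive-≈ a≈x
movable-≈ {⟨ _ , _ , _ ⟩} {⟨ _ , _ , _ ⟩} (_ , b≈y , _) b↦a = positive-≈ b≈y
movable-≈ {⟨ _ , _ , _ ⟩} {⟨ _ , _ , _ ⟩} (_ , b≈y , _) b↦c = positive-≈ b≈y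
movable-≈ {⟨ _ , _ , _ ⟩} {⟨ _ , _ , _ ⟩} (_ , _ , c≈z) c↦a = positive-≈ c≈z
movable-≈ {⟨ _ , _ , _ ⟩} {⟨ _ , _ , _ ⟩} (_ , _ , c≈z) c↦b = positive-≈ c≈z

deg-≈ : ∀ {u v} → u ≈ₚ v → deg u ≡₃ deg v
deg-≈ {⟨ a , b , c ⟩} {⟨ x , y , z ⟩} ((_ , ax) , (_ , by) , (_ , cz)) =
  +-≡₃ a _ x _ ax (+-≡₃ b _ y _ by (+-≡₃ c 0 z 0 cz refl))
  where
    +-≡₃ : ∀ m n m′ n′ → m ≡₃ m′ → n ≡₃ n′ → m + n ≡₃ m′ + n′
    +-≡₃ m n m′ n′ mm nn = begin
      (m + n) % 3           ≡⟨ %-distribˡ-+ m n 3 ⟩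
      (m % 3 + n % 3) % 3   ≡⟨ cong₂ (λ r s → (r + s) % 3) mm nn ⟩
      (m′ % 3 + n′ % 3) % 3 ≡⟨ %-distribˡ-+ m′ n′ 3 ⟨
      (m′ + n′) % 3         ∎
      where open ≡-Reasoning

weightThrough-≈ : ∀ {u v} → u ≈ₚ v → ∀ m → weightThrough u m ≡ weightThrough v m
weightThrough-≈ u≈v m = cong sum (map-cong (λ s → cong (if hasCorner s m then_else 0) (weight-≈ u≈v s)) allShapes)

coverage-encode : ∀ q → coverage (encode q) ≡ coverage q
coverage-encode q = cong sum (map-cong contribution-encode allMoves)
  where
    contribution-encode : ∀ m → contribution (encode q) m ≡ contribution q m
    contribution-encode m =
      cong₂ (λ b w → if b then w else 0)
            (cong₂ _∧_ (movable-≈ (encode-≈ q) m) (congruent-≈ (move-encode-≈ m q)))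
            (weightThrough-≈ (move-encode-≈ m q) (opposite m))

totalWeight-≈ : ∀ {u v} → u ≈ₚ v → totalWeight u ≡ totalWeight v
totalWeight-≈ u≈v = cong sum (map-cong (weight-≈ u≈v) allShapes)

≈ₚ-sym : ∀ {u v} → u ≈ₚ v → v ≈ₚ u
≈ₚ-sym {⟨ _ , _ , _ ⟩} {⟨ _ , _ , _ ⟩} ((a₄ , a₃) , (b₄ , b₃) , (c₄ , c₃)) =
  (sym a₄ , sym a₃) , (sym b₄ , sym b₃) , (sym c₄ , sym c₃)

Congruent-≈ : ∀ {u v} → u ≈ₚ v → Congruent u → Congruent v
Congruent-≈ {⟨ _ , _ , _ ⟩} {⟨ _ , _ , _ ⟩} ((_ , ax) , (_ , by) , (_ , cz)) (ab , ac) =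
  trans (sym ax) (trans ab by) , trans (sym ax) (trans ac cz)

anchor : Point → Shape
anchor ⟨ a , b , c ⟩ = if positive b then (if positive c then D₁₂ else U₁) else (if positive c then U₂ else U₀)

anchor-≈ : ∀ {u v} → u ≈ₚ v → anchor u ≡ anchor v
anchor-≈ {⟨ _ , _ , _ ⟩} {⟨ _ , _ , _ ⟩} (_ , b≈y , c≈z) rewrite positive-≈ b≈y | positive-≈ c≈z = refl

Small : Point → Set
Small ⟨ a , b , c ⟩ = a < 5 × b < 5 × c < 5

bonus : Point → ℕ
bonus ⟨ _ , 1 , 0 ⟩ = 1
bonus ⟨ _ , 0 , 1 ⟩ = 1
bonus _ = 0

-- The extra unit for ⟨ _ , 1 , 0 ⟩ and ⟨ _ , 0 , 1 ⟩ is the slack that keeps the neighbours of the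
-- corner out of a maximum independent set. Small p → deg p ≢ 6 exempts the points of G₃(6) whose
-- coordinates are all below 5 (these represent only themselves), where the covering bound fails.
Acceptable : Point → Set
Acceptable p =
  (Congruent p → deg p ≢ 0 → totalWeight p ≡ 12 × 1 ≤ weight p (anchor p)) ×
  (¬ Congruent p → deg p % 3 ≡ 0 → (Small p → deg p ≢ 6) → 12 + bonus p ≤ coverage p)

acceptable? : Decidable Acceptable
acceptable? p@(⟨ a , b , c ⟩) =
  (congruent? p →-dec (¬? (deg p ≟ 0) →-dec ((totalWeight p ≟ 12) ×-dec (1 ≤? weight p (anchor p))))) ×-dec
  (¬? (congruent? p) →-dec ((deg p % 3 ≟ 0) →-dec
    ((((a <? 5) ×-dec (b <? 5) ×-dec (c <? 5)) →-dec ¬? (deg p ≟ 6)) →-dec (12 + bonus p ≤? coverage p))))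

certificate : All Acceptable (box 8)
certificate = from-yes (all? acceptable? (box 8))

acceptable-encode : ∀ q → Acceptable (encode q)
acceptable-encode ⟨ a , b , c ⟩ = All.lookup certificate (∈-box (enc<8 a) (enc<8 b) (enc<8 c))

encode-small : ∀ q → Small (encode q) → encode q ≡ q
encode-small ⟨ a , b , c ⟩ (a< , b< , c<) rewrite enc<5 a a< | enc<5 b b< | enc<5 c c< = refl

deg-encode≡0 : ∀ q → deg (encode q) ≡ 0 → deg q ≡ 0
deg-encode≡0 ⟨ a , b , c ⟩ e
  with enc≡0 a (m+n≡0⇒m≡0 (enc a) e) | enc≡0 b (m+n≡0⇒m≡0 (enc b) (m+n≡0⇒n≡0 (enc a) e))
     | enc≡0 c (m+n≡0⇒m≡0 (enc c) (m+n≡0⇒n≡0 (enc b) (m+n≡0⇒n≡0 (enc a) e)))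
... | refl | refl | refl = refl

congruent-weights : ∀ {p} → Congruent p → deg p ≢ 0 → totalWeight p ≡ 12 × 1 ≤ weight p (anchor p)
congruent-weights {p} cp d≢0
  with proj₁ (acceptable-encode p) (Congruent-≈ (≈ₚ-sym (encode-≈ p)) cp) (d≢0 ∘ deg-encode≡0 p)
... | total , anchored =
  trans (sym (totalWeight-≈ (encode-≈ p))) total ,
  subst (1 ≤_) (trans (cong (weight (encode p)) (anchor-≈ (encode-≈ p))) (weight-≈ (encode-≈ p) (anchor p))) anchored

coverage-bound : ∀ {q} → ¬ Congruent q → deg q % 3 ≡ 0 → deg q ≢ 6 → 12 + bonus (encode q) ≤ coverage q
coverage-bound {q} nc d%3 d≢6 =
  subst (12 + bonus (encode q) ≤_) (coverage-encode q)
        (proj₂ (acceptable-encode q) (nc ∘ Congruent-≈ (encode-≈ q)) (trans (deg-≈ (encode-≈ q)) d%3)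
               (λ small → subst (λ p → deg p ≢ 6) (sym (encode-small q small)) d≢6))

congruentPoints-independent : ∀ d → IsIndependent 3 d (congruentPoints d)
congruentPoints-independent d = (congruentPoints-unique d , All.tabulate (proj₁ ∘ member)) , independent
  where
    member : ∀ {p} → p ∈ congruentPoints d → deg p ≡ d × Congruent p
    member = ∈-congruentPoints⁻ {d}
    independent : ∀ {p q} → p ∈ congruentPoints d → q ∈ congruentPoints d → ¬ Adj 3 d p q
    independent p∈ q∈ with member p∈ | member q∈
    ... | dp , cp | dq , cq = congruent-independent cp cq dp dq

module CoverArgument (d : ℕ) (d%3≡0 : d % 3 ≡ 0) (d≢0 : d ≢ 0) (d≢6 : d ≢ 6) where

  C : List Point
  C = congruentPoints d

  L : List (List Point)
  L = cover d

  weights-at : ∀ {p} → p ∈ C → totalWeight p ≡ 12 × 1 ≤ weight p (anchor p)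
  weights-at p∈C with ∈-congruentPoints⁻ {d} p∈C
  ... | dp , cp = congruent-weights cp (λ e → d≢0 (trans (sym dp) e))

  length-L : length L ≡ 12 * length C
  length-L = trans (length-cover d) (sum-map-const totalWeight 12 C (proj₁ ∘ weights-at))

  coverage-at : ∀ {u} → deg u ≡ d → ¬ Congruent u → 12 + bonus (encode u) ≤ coverage u
  coverage-at du nc = coverage-bound nc (trans (cong (_% 3) du) d%3≡0) (λ e → d≢6 (trans (sym du) e))

  multiplicity-non-congruent : ∀ {u} → deg u ≡ d → ¬ Congruent u → 12 + bonus (encode u) ≤ multiplicity u L
  multiplicity-non-congruent du nc = ≤-trans (coverage-at du nc) (coverage-≤ du)

  multiplicity-≥12 : ∀ {u} → deg u ≡ d → 12 ≤ multiplicity u L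
  multiplicity-≥12 {u} du with congruent? u
  ... | no nc = ≤-trans (m≤m+n 12 _) (multiplicity-non-congruent du nc)
  ... | yes cu = begin
    12                        ≡⟨ proj₁ (weights-at u∈C) ⟨
    totalWeight u             ≡⟨ multiplicity-own-block u ⟨
    multiplicity u (block u)  ≤⟨ multiplicity-block-≤ {d} u u∈C ⟩
    multiplicity u L          ∎
    where
      open ≤-Reasoning
      u∈C : u ∈ C
      u∈C = ∈-congruentPoints⁺ du cu

  module _ (J : List Point) (J-independent : IsIndependent 3 d J) where

    J-unique : Unique J
    J-unique = proj₁ (proj₁ J-independent)

    J-degree : ∀ {u} → u ∈ J → deg u ≡ d
    J-degree = All.lookup (proj₂ (proj₁ J-independent))

    J-lower : 12 * length J ≤ incidences J L
    J-lower = sum-map-≥ (λ u → multiplicity u L) 12 J (multiplicity-≥12 ∘ J-degree)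

    J-upper : incidences J L ≤ length L
    J-upper = incidences-≤ (Adj 3 d) J L J-unique (proj₂ J-independent) cover-cliques

    independence-bound : length J ≤ length C
    independence-bound = *-cancelˡ-≤ 12 (≤-trans J-lower (≤-trans J-upper (≤-reflexive length-L)))

    module Maximum (C≤J : length C ≤ length J) where

      L≤12J : length L ≤ 12 * length J
      L≤12J = ≤-trans (≤-reflexive length-L) (*-monoʳ-≤ 12 C≤J)

      hit : ∀ {K} → K ∈ L → ∃ λ u → u ∈ J × u ∈ K
      hit {K} K∈L with any? (_∈? K) J
      ... | yes some = find some
      ... | no none = ⊥-elim (<⇒≱ missed (≤-trans L≤12J J-lower))
        where
          missed : incidences J L < length L
          missed = incidences-< (Adj 3 d) J L J-unique (proj₂ J-independent) cover-cliques
                                K∈L (λ u∈J u∈K → none (lose u∈J u∈K))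

      no-slack : ∀ {u} → u ∈ J → 12 < multiplicity u L → ⊥
      no-slack u∈J slack =
        <⇒≱ (sum-map-> (λ u → multiplicity u L) 12 J u∈J slack (multiplicity-≥12 ∘ J-degree)) (≤-trans J-upper L≤12J)

      J-adjacent : ∀ {u v} → u ∈ J → v ∈ J → Step u v → ⊥
      J-adjacent u∈J v∈J s = proj₂ J-independent u∈J v∈J (step⇒adj (J-degree u∈J) s)

      via : ∀ u {v w} → Step u v → Step v w → deg w ≡ d → deg u ≡ d
      via _ s t e = trans (deg-step s) (trans (deg-step t) e)

      anchor-rule : ∀ {p} → p ∈ C → (∀ {v} → v ∈ J → v ∈ oppositeSide p (anchor p) → ⊥) → p ∈ J
      anchor-rule {p} p∈C excluded with hit (∈-cover {d} (anchor p) p∈C (proj₂ (weights-at p∈C)))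
      ... | _ , u∈J , here refl = u∈J
      ... | _ , u∈J , there u∈side = ⊥-elim (excluded u∈J u∈side)

      corner : ∀ {a} → deg ⟨ a , 0 , 0 ⟩ ≡ d → ⟨ a , 0 , 0 ⟩ ∈ J
      corner {zero} e = ⊥-elim (d≢0 (sym e))
      corner {suc a} e = anchor-rule (∈-congruentPoints⁺ e (residue , residue)) excluded
        where
          residue : suc a ≡₃ 0
          residue = trans (cong (_% 3) (trans (sym (+-identityʳ (suc a))) e)) d%3≡0
          tight : ∀ {v} → v ∈ J → deg v ≡ d → ¬ Congruent v → bonus (encode v) ≡ 1 → ⊥
          tight {v} v∈J dv nc one =
            no-slack v∈J (subst (λ k → 12 + k ≤ multiplicity v L) one (multiplicity-non-congruent dv nc))
          excluded : ∀ {v} → v ∈ J → v ∈ oppositeSide ⟨ suc a , 0 , 0 ⟩ U₀ → ⊥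
          excluded v∈J (here refl) =
            tight v∈J (trans (deg-step (b↦a {a} {0} {0})) e) (λ (e₁ , e₂) → 1+n≢0 (trans (sym e₁) e₂)) refl
          excluded v∈J (there (here refl)) =
            tight v∈J (trans (deg-step (c↦a {a} {0} {0})) e) (λ (e₁ , e₂) → 1+n≢0 (trans (sym e₂) e₁)) refl

      congruent-in-J : ∀ n a b c → b + c ≤ n → Congruent ⟨ a , b , c ⟩ → deg ⟨ a , b , c ⟩ ≡ d →
                       ⟨ a , b , c ⟩ ∈ J
      congruent-in-J n a 0 0 _ _ e = corner e
      congruent-in-J n a 0 1 _ (ab , ac) _ = ⊥-elim (0≢1+n (trans (sym ab) ac))
      congruent-in-J n a 0 2 _ (ab , ac) _ = ⊥-elim (0≢1+n (trans (sym ab) ac))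
      congruent-in-J n a 1 0 _ (ab , ac) _ = ⊥-elim (0≢1+n (trans (sym ac) ab))
      congruent-in-J n a 2 0 _ (ab , ac) _ = ⊥-elim (0≢1+n (trans (sym ac) ab))
      congruent-in-J (suc n) a 0 (suc (suc (suc c))) le (ab , ac) e =
        anchor-rule (∈-congruentPoints⁺ e (ab , ac)) excluded
        where
          p′∈J : ⟨ suc a , 1 , suc c ⟩ ∈ J
          p′∈J = congruent-in-J n (suc a) 1 (suc c) (≤-pred le) (≡₃-suc a 0 ab , ≡₃-suc a c ac)
                                (via ⟨ suc a , 1 , suc c ⟩ a↦c b↦c e)
          excluded : ∀ {v} → v ∈ J → v ∈ oppositeSide ⟨ a , 0 , suc (suc (suc c)) ⟩ U₂ → ⊥
          excluded v∈J (here refl) = J-adjacent p′∈J v∈J b↦c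
          excluded v∈J (there (here refl)) = J-adjacent p′∈J v∈J a↦c
      congruent-in-J (suc n) a (suc (suc (suc b))) 0 le (ab , ac) e =
        anchor-rule (∈-congruentPoints⁺ e (ab , ac)) excluded
        where
          le′ : suc b + 1 ≤ n
          le′ = ≤-trans (≤-reflexive (+-comm (suc b) 1)) (≤-pred (≤-trans (≤-reflexive (sym (+-identityʳ _))) le))
          p′∈J : ⟨ suc a , suc b , 1 ⟩ ∈ J
          p′∈J = congruent-in-J n (suc a) (suc b) 1 le′ (≡₃-suc a b ab , ≡₃-suc a 0 ac)
                                (via ⟨ suc a , suc b , 1 ⟩ a↦b c↦b e)
          excluded : ∀ {v} → v ∈ J → v ∈ oppositeSide ⟨ a , suc (suc (suc b)) , 0 ⟩ U₁ → ⊥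
          excluded v∈J (here refl) = J-adjacent p′∈J v∈J c↦b
          excluded v∈J (there (here refl)) = J-adjacent p′∈J v∈J a↦b
      congruent-in-J (suc n) a (suc b) (suc c) le (ab , ac) e =
        anchor-rule (∈-congruentPoints⁺ e (ab , ac)) excluded
        where
          p′∈J : ⟨ suc (suc a) , b , c ⟩ ∈ J
          p′∈J = congruent-in-J n (suc (suc a)) b c (≤-trans (+-monoʳ-≤ b (n≤1+n c)) (≤-pred le))
                                (≡₃-suc (suc a) (suc (suc b)) (≡₃-suc a (suc b) ab) ,
                                 ≡₃-suc (suc a) (suc (suc c)) (≡₃-suc a (suc c) ac))
                                (via ⟨ suc (suc a) , b , c ⟩ a↦b a↦c e)
          excluded : ∀ {v} → v ∈ J → v ∈ oppositeSide ⟨ a , suc b , suc c ⟩ D₁₂ → ⊥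
          excluded v∈J (here refl) = J-adjacent p′∈J v∈J a↦c
          excluded v∈J (there (here refl)) = J-adjacent p′∈J v∈J a↦b
      congruent-in-J zero a 0 (suc c) () _ _
      congruent-in-J zero a (suc b) c () _ _

      C⊆J : ∀ {p} → p ∈ C → p ∈ J
      C⊆J {⟨ a , b , c ⟩} p∈C with ∈-congruentPoints⁻ {d} p∈C
      ... | e , cp = congruent-in-J (b + c) a b c ≤-refl cp e

      J⊆C : ∀ {u} → u ∈ J → u ∈ C
      J⊆C {u} u∈J with congruent? u
      ... | yes cu = ∈-congruentPoints⁺ (J-degree u∈J) cu
      ... | no nc with congruent-neighbour u (≤-trans (s≤s z≤n) (coverage-at (J-degree u∈J) nc))
      ... | m , step , cm =
        ⊥-elim (J-adjacent u∈J (C⊆J (∈-congruentPoints⁺ (trans (sym (deg-step step)) (J-degree u∈J)) cm)) step)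

origin-only : ∀ {p} → deg p ≡ 0 → p ≡ ⟨ 0 , 0 , 0 ⟩
origin-only {⟨ 0 , 0 , 0 ⟩} _ = refl
origin-only {⟨ suc _ , _ , _ ⟩} ()
origin-only {⟨ 0 , suc _ , _ ⟩} ()
origin-only {⟨ 0 , 0 , suc _ ⟩} ()

degree-zero-unique : HasUniqueMaxIndependentSet 3 0
degree-zero-unique =
  origin ∷ [] , (origin-independent , at-most-one) , λ J J-maximum _ → mk⇔ (only J J-maximum) (present J J-maximum)
  where
    origin : Point
    origin = ⟨ 0 , 0 , 0 ⟩
    origin-independent : IsIndependent 3 0 (origin ∷ [])
    origin-independent = (([] ∷ []) , (refl ∷ [])) , λ { (here refl) (here refl) () }
    at-most-one : ∀ J → IsIndependent 3 0 J → length J ≤ 1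
    at-most-one [] _ = z≤n
    at-most-one (_ ∷ []) _ = s≤s z≤n
    at-most-one (_ ∷ _ ∷ _) (((x≢ ∷ _) , (dx ∷ dy ∷ _)) , _) =
      ⊥-elim (All.lookup x≢ (here refl) (trans (origin-only dx) (sym (origin-only dy))))
    only : ∀ J → IsMaximumIndependent 3 0 J → ∀ {f} → f ∈ J → f ∈ origin ∷ []
    only J (((_ , degrees) , _) , _) f∈J = here (origin-only (All.lookup degrees f∈J))
    present : ∀ J → IsMaximumIndependent 3 0 J → ∀ {f} → f ∈ origin ∷ [] → f ∈ J
    present [] (_ , maximal) _ with () ← maximal (origin ∷ []) origin-independent
    present (x ∷ _) (((_ , (dx ∷ _)) , _) , _) (here refl) = here (sym (origin-only dx))

theorem2p1 : (d : ℕ) → d % 3 ≡ 0 → d ≢ 6 → HasUniqueMaxIndependentSet 3 d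
theorem2p1 zero _ _ = degree-zero-unique
theorem2p1 d@(suc _) d%3≡0 d≢6 =
  congruentPoints d ,
  (congruentPoints-independent d , independence-bound) ,
  λ J (J-independent , J-maximal) f →
    let open Maximum J J-independent (J-maximal (congruentPoints d) (congruentPoints-independent d))
    in mk⇔ J⊆C C⊆J
  where open CoverArgument d d%3≡0 (λ ()) d≢6
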